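{- Let $k,t,p,q$ be positive integers and suppose $C_{p,q}$, of size $n\times n$ with $n=p+q$, is a submatrix of $A_{k,t}$. Then $n\le\binom{2t}{t}+q-1$, that is, $p\le\binom{2t}{t}-1$.
   Context: For positive integers $k,t$ with $k\ge t$, $A_{k,t}$ is the $0,1$-matrix of size $\binom{k}{t}\times\binom{k}{t}$ whose rows and columns are indexed by all $t$-element subsets of $[k]=\{1,\dots,k\}$, with entry $1$ in row $x$, column $y$ if and only if $x\cap y\neq\emptyset$. For integers $p\ge 1$, $q\ge 0$ and $n=p+q$, $C_{p,q}$ is the $n\times n$ circulant $0,1$-matrix whose entry in row $i$, column $j$ ($1\le i,j\le n$) is $1$ iff $(i-j) \bmod n \in\{0,1,\dots,p-1\}$. An $n\times m$ $0,1$-matrix $M$ is a submatrix of $A_{k,t}$ if there are distinct $t$-subsets $F_1,\dots,F_n$ of $[k]$ and distinct $t$-subsets $G_1,\dots,G_m$ of $[k]$ with $M_{ij}=1$ iff $F_i\cap G_j\ne\emptyset$. -}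

module Defs where

open import Data.Nat using (ℕ; _+_; _∸_; _<_; NonZero)
open import Data.Nat.DivMod using (_%_)
open import Data.Fin using (Fin; toℕ)
open import Data.Fin.Subset using (Subset; _∩_; ∣_∣; Nonempty)
open import Data.Product using (_×_)
open import Function.Definitions using (Injective)
open import Relation.Binary.PropositionalEquality using (_≡_)
open import Function.Bundles using (_⇔_)

IsTSubset : ∀ {k} → ℕ → Subset k → Set
IsTSubset t s = ∣ s ∣ ≡ t

-- Entry of A_{k,t}: 1 iff the two sets intersect.
Intersects : ∀ {k} → Subset k → Subset k → Set
Intersects x y = Nonempty (x ∩ y)

CEntry : (p q : ℕ) .{{_ : NonZero (p + q)}} → Fin (p + q) → Fin (p + q) → Set
CEntry p q i j = ((toℕ i + (p + q)) ∸ toℕ j) % (p + q) < p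

CircSubmatrixOf : (p q : ℕ) .{{_ : NonZero (p + q)}} → (k t : ℕ) → Set
CircSubmatrixOf p q k t =
  Σ (Fin (p + q) → Subset k) λ F → Σ (Fin (p + q) → Subset k) λ G →
    Injective _≡_ _≡_ F × Injective _≡_ _≡_ G ×
    (∀ i → IsTSubset t (F i)) × (∀ j → IsTSubset t (G j)) ×
    (∀ i j → CEntry p q i j ⇔ Intersects (F i) (G j))
  where open import Data.Product using (Σ)

-- If C_{p+1,q+1} (size n = p+q+2) is a submatrix of A_{k,t} with rows F_i and
-- columns G_j, put A_i = F_i and B_i = G_{i+1 mod n} for i = 0,…,p+1.  The
-- circulant pattern makes this a skew cross-intersecting family:
-- A_i ∩ B_i = ∅, while A_i ∩ B_j ≠ ∅ for j < i.  The skew Bollobás theorem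
-- (Frankl, Lovász) bounds such a family of a-sets and b-sets by C(a+b,b), so
-- p+2 ≤ C(2t,t), which is the claim.
--
-- The skew Bollobás theorem is proved by the polynomial method over ℤ:
--  * TriangularRank: vectors w_i, β_j ∈ ℤᴺ with ⟨w_i,β_j⟩ = 0 for j < i and
--    ⟨w_i,β_i⟩ ≠ 0 number at most N (Gaussian elimination);
--  * HomogeneousPolynomials: the degree-d monomials in v variables, C(v-1+d,d)
--    of them, span every product of d linear forms;
--  * SkewBollobas: encode A by the coefficients c_A of ∏_{x∈A}(z₀ - x z₁) and B
--    by f_B(c) = ∏_{y∈B} ⟨moment(y), c⟩; then f_B(c_A) = ∏_{y∈B}∏_{x∈A}(y - x),
--    which vanishes exactly when A ∩ B ≠ ∅.

module Submission where

module IntegerVectors where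

  open import Data.Nat using (suc)
  open import Data.Integer using (ℤ; _+_; _*_; 0ℤ)
  open import Data.Integer.Properties using (+-*-semiring; *-zeroʳ; +-identityˡ; _≟_)
  open import Data.Integer.Tactic.RingSolver using (solve-∀)
  open import Algebra.Properties.Semiring.Sum +-*-semiring public
    using (sum; sum-cong-≗; sum-replicate-zero; sum-remove; ∑-distrib-+; ∑-comm;
           *-distribˡ-sum; *-distribʳ-sum)
  open import Data.Fin using (Fin; punchIn)
  open import Data.Fin.Properties using (¬∀⟶∃¬)
  open import Data.Vec.Functional public using (Vector)
  open import Data.Product using (∃)
  open import Function using (_∘_)
  open import Relation.Nullary using (¬_)
  open import Relation.Binary.PropositionalEquality

  infix 7 _·_

  _·_ : ∀ {n} → Vector ℤ n → Vector ℤ n → ℤ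
  u · v = sum (λ k → u k * v k)

  ·-zeroʳ : ∀ {n} (u v : Vector ℤ n) → (∀ k → v k ≡ 0ℤ) → u · v ≡ 0ℤ
  ·-zeroʳ {n} u v v≡0 =
    trans (sum-cong-≗ (λ k → trans (cong (u k *_) (v≡0 k)) (*-zeroʳ (u k))))
          (sum-replicate-zero n)

  nonzeroCoordinate : ∀ {n} (u v : Vector ℤ n) → ¬ u · v ≡ 0ℤ → ∃ λ k → ¬ v k ≡ 0ℤ
  nonzeroCoordinate {n} u v u·v≢0 =
    ¬∀⟶∃¬ n (λ k → v k ≡ 0ℤ) (λ k → v k ≟ 0ℤ) (u·v≢0 ∘ ·-zeroʳ u v)

  ·-linearʳ : ∀ {n} a b (u v v′ : Vector ℤ n) →
    u · (λ k → a * v k + b * v′ k) ≡ a * (u · v) + b * (u · v′)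
  ·-linearʳ a b u v v′ = begin
      sum (λ k → u k * (a * v k + b * v′ k))
    ≡⟨ sum-cong-≗ (λ k → expand a b (u k) (v k) (v′ k)) ⟩
      sum (λ k → a * (u k * v k) + b * (u k * v′ k))
    ≡⟨ ∑-distrib-+ (λ k → a * (u k * v k)) (λ k → b * (u k * v′ k)) ⟩
      sum (λ k → a * (u k * v k)) + sum (λ k → b * (u k * v′ k))
    ≡⟨ sym (cong₂ _+_ (*-distribˡ-sum a (λ k → u k * v k)) (*-distribˡ-sum b (λ k → u k * v′ k))) ⟩
      a * (u · v) + b * (u · v′)
    ∎
    where
    open ≡-Reasoning
    expand : ∀ a b x y y′ → x * (a * y + b * y′) ≡ a * (x * y) + b * (x * y′)
    expand = solve-∀

  ·-punchOut : ∀ {n} (i : Fin (suc n)) (u v : Vector ℤ (suc n)) → v i ≡ 0ℤ →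
    u · v ≡ (u ∘ punchIn i) · (v ∘ punchIn i)
  ·-punchOut i u v vi≡0 =
    trans (sum-remove {i = i} (λ k → u k * v k))
          (trans (cong (_+ (u ∘ punchIn i) · (v ∘ punchIn i)) (trans (cong (u i *_) vi≡0) (*-zeroʳ (u i))))
                 (+-identityˡ _))


module TriangularRank where

  open import Data.Nat as ℕ using (ℕ; zero; suc; z≤n; s≤s)
  open import Data.Integer using (ℤ; _+_; _*_; -_; 0ℤ)
  open import Data.Integer.Properties using (*-zeroʳ; i*j≡0⇒i≡0∨j≡0)
  open import Data.Integer.Tactic.RingSolver using (solve-∀)
  open import Data.Fin using (Fin; zero; suc; punchIn; _<_)
  open import Data.Product using (_,_)
  open import Data.Sum using ([_,_]′)
  open import Function using (_∘_)
  open import Relation.Nullary using (¬_)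
  open import Relation.Binary.PropositionalEquality
  open IntegerVectors

  -- Proof: pivot on a coordinate k with
  -- β₀(k) = c ≠ 0, replace β_{j+1} by c·β_{j+1} - β_{j+1}(k)·β₀ (which
  -- vanishes at k), delete coordinate k, and recurse.
  triangularRank : ∀ m N (w β : Fin m → Vector ℤ N) →
    (∀ i j → j < i → w i · β j ≡ 0ℤ) → (∀ i → ¬ w i · β i ≡ 0ℤ) → m ℕ.≤ N
  triangularRank zero N w β lower diagonal = z≤n
  triangularRank (suc m) N w β lower diagonal
    with nonzeroCoordinate (w zero) (β zero) (diagonal zero)
  triangularRank (suc m) zero    w β lower diagonal | () , _
  triangularRank (suc m) (suc N) w β lower diagonal | k , c≢0 =
    s≤s (triangularRank m N w′ β′ lower′ diagonal′)
    where
    c : ℤ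
    c = β zero k

    γ : Fin m → Vector ℤ (suc N)
    γ j l = c * β (suc j) l + (- β (suc j) k) * β zero l

    γ-pivot : ∀ j → γ j k ≡ 0ℤ
    γ-pivot j = cancel c (β (suc j) k)
      where
      cancel : ∀ x y → x * y + (- y) * x ≡ 0ℤ
      cancel = solve-∀

    w′ β′ : Fin m → Vector ℤ N
    w′ i = w (suc i) ∘ punchIn k
    β′ j = γ j ∘ punchIn k

    -- Since ⟨w_{i+1},β₀⟩ = 0, elimination only rescales the pairings by c.
    pairing : ∀ i j → w′ i · β′ j ≡ c * (w (suc i) · β (suc j))
    pairing i j = begin
        w′ i · β′ j
      ≡⟨ sym (·-punchOut k (w (suc i)) (γ j) (γ-pivot j)) ⟩
        w (suc i) · γ j
      ≡⟨ ·-linearʳ c (- β (suc j) k) (w (suc i)) (β (suc j)) (β zero) ⟩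
        c * (w (suc i) · β (suc j)) + (- β (suc j) k) * (w (suc i) · β zero)
      ≡⟨ cong (λ z → c * (w (suc i) · β (suc j)) + (- β (suc j) k) * z) (lower (suc i) zero (s≤s z≤n)) ⟩
        c * (w (suc i) · β (suc j)) + (- β (suc j) k) * 0ℤ
      ≡⟨ dropZero (c * (w (suc i) · β (suc j))) (- β (suc j) k) ⟩
        c * (w (suc i) · β (suc j))
      ∎
      where
      open ≡-Reasoning
      dropZero : ∀ x y → x + y * 0ℤ ≡ x
      dropZero = solve-∀

    lower′ : ∀ i j → j < i → w′ i · β′ j ≡ 0ℤ
    lower′ i j j<i =
      trans (pairing i j) (trans (cong (c *_) (lower (suc i) (suc j) (s≤s j<i))) (*-zeroʳ c))

    diagonal′ : ∀ i → ¬ w′ i · β′ i ≡ 0ℤ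
    diagonal′ i e =
      [ c≢0 , diagonal (suc i) ]′ (i*j≡0⇒i≡0∨j≡0 c (trans (sym (pairing i i)) e))


module SubsetProducts where

  open import Data.Integer using (ℤ; _*_; 0ℤ; 1ℤ)
  open import Data.Integer.Properties using (*-zeroʳ; i*j≡0⇒i≡0∨j≡0)
  open import Data.Fin using (Fin; zero; suc)
  open import Data.Fin.Subset using (Subset; _∈_)
  open import Data.Vec using ([]; _∷_; here; there)
  open import Data.Bool using (true; false)
  open import Data.Product using (∃; _×_; _,_)
  open import Data.Sum using (inj₁; inj₂)
  open import Function using (_∘_)
  open import Relation.Binary.PropositionalEquality

  ∏ : ∀ {k} → Subset k → (Fin k → ℤ) → ℤ
  ∏ []          g = 1ℤ
  ∏ (true ∷ s)  g = g zero * ∏ s (g ∘ suc)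
  ∏ (false ∷ s) g = ∏ s (g ∘ suc)

  ∏-cong : ∀ {k} (s : Subset k) {g h : Fin k → ℤ} → (∀ y → g y ≡ h y) → ∏ s g ≡ ∏ s h
  ∏-cong []          g≡h = refl
  ∏-cong (true ∷ s)  g≡h = cong₂ _*_ (g≡h zero) (∏-cong s (g≡h ∘ suc))
  ∏-cong (false ∷ s) g≡h = ∏-cong s (g≡h ∘ suc)

  ∏≡0⇒factor≡0 : ∀ {k} (s : Subset k) (g : Fin k → ℤ) → ∏ s g ≡ 0ℤ → ∃ λ y → y ∈ s × g y ≡ 0ℤ
  ∏≡0⇒factor≡0 []          g ()
  ∏≡0⇒factor≡0 (true ∷ s)  g e with i*j≡0⇒i≡0∨j≡0 (g zero) e
  ... | inj₁ g0≡0 = zero , here , g0≡0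
  ... | inj₂ rest≡0 with ∏≡0⇒factor≡0 s (g ∘ suc) rest≡0
  ...   | y , y∈s , gy≡0 = suc y , there y∈s , gy≡0
  ∏≡0⇒factor≡0 (false ∷ s) g e with ∏≡0⇒factor≡0 s (g ∘ suc) e
  ... | y , y∈s , gy≡0 = suc y , there y∈s , gy≡0

  factor≡0⇒∏≡0 : ∀ {k} (s : Subset k) (g : Fin k → ℤ) y → y ∈ s → g y ≡ 0ℤ → ∏ s g ≡ 0ℤ
  factor≡0⇒∏≡0 (true ∷ s)  g zero    here       gy≡0 = cong (_* ∏ s (g ∘ suc)) gy≡0
  factor≡0⇒∏≡0 (true ∷ s)  g (suc y) (there y∈s) gy≡0 =
    trans (cong (g zero *_) (factor≡0⇒∏≡0 s (g ∘ suc) y y∈s gy≡0)) (*-zeroʳ (g zero))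
  factor≡0⇒∏≡0 (false ∷ s) g (suc y) (there y∈s) gy≡0 = factor≡0⇒∏≡0 s (g ∘ suc) y y∈s gy≡0


-- Homogeneous polynomial functions ℤᵛ → ℤ, as spans of monomial functions.
module HomogeneousPolynomials where

  open import Data.Nat as ℕ using (ℕ; zero; suc)
  import Data.Nat.Properties as ℕₚ
  open import Data.Nat.Combinatorics using (_C_; nCn≡1; nCk+nC[k+1]≡[n+1]C[k+1])
  open import Data.Integer using (ℤ; _+_; _*_; 0ℤ; 1ℤ)
  open import Data.Integer.Properties using (*-assoc; *-identityˡ; *-zeroˡ; +-identityˡ; +-identityʳ)
  open import Data.Integer.Tactic.RingSolver using (solve-∀)
  open import Data.Fin using (Fin; zero; suc; splitAt; _↑ˡ_; _↑ʳ_)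
  open import Data.Fin.Properties using (splitAt-↑ˡ; splitAt-↑ʳ)
  open import Data.Fin.Subset using (Subset; ∣_∣)
  open import Data.Vec using ([]; _∷_)
  open import Data.Vec.Functional using (tail)
  open import Data.Bool using (true; false)
  open import Data.Product using (Σ; _,_; proj₁; proj₂)
  open import Data.Sum using ([_,_]′; inj₁; inj₂)
  open import Function using (_∘_)
  open import Relation.Binary.PropositionalEquality
  open IntegerVectors
  open SubsetProducts

  InSpan : ∀ {v n} → (Fin n → Vector ℤ v → ℤ) → (Vector ℤ v → ℤ) → Set
  InSpan {n = n} g f = Σ (Vector ℤ n) λ a → ∀ x → f x ≡ sum (λ k → a k * g k x)

  module _ {v n} {g : Fin n → Vector ℤ v → ℤ} where

    InSpan-resp : ∀ {f f′} → InSpan g f → (∀ x → f′ x ≡ f x) → InSpan g f′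
    InSpan-resp (a , f≡) f′≡f = a , λ x → trans (f′≡f x) (f≡ x)

    InSpan-scale : ∀ {f} (φ : Vector ℤ v → ℤ) →
      InSpan g f → InSpan (λ k x → φ x * g k x) (λ x → φ x * f x)
    InSpan-scale {f} φ (a , f≡) = a , λ x → begin
        φ x * f x
      ≡⟨ cong (φ x *_) (f≡ x) ⟩
        φ x * sum (λ k → a k * g k x)
      ≡⟨ *-distribˡ-sum (φ x) (λ k → a k * g k x) ⟩
        sum (λ k → φ x * (a k * g k x))
      ≡⟨ sum-cong-≗ (λ k → swap (φ x) (a k) (g k x)) ⟩
        sum (λ k → a k * (φ x * g k x))
      ∎
      where
      open ≡-Reasoning
      swap : ∀ p q r → p * (q * r) ≡ q * (p * r)
      swap = solve-∀

    InSpan-trans : ∀ {m} {h : Fin m → Vector ℤ v → ℤ} {f} →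
      (∀ k → InSpan h (g k)) → InSpan g f → InSpan h f
    InSpan-trans {m} {h} {f} g∈h (a , f≡) = (λ r → sum (λ k → a k * b k r)) , λ x → begin
        f x
      ≡⟨ f≡ x ⟩
        sum (λ k → a k * g k x)
      ≡⟨ sum-cong-≗ (λ k → trans (cong (a k *_) (g≡ k x)) (*-distribˡ-sum (a k) (λ r → b k r * h r x))) ⟩
        sum (λ k → sum (λ r → a k * (b k r * h r x)))
      ≡⟨ ∑-comm (λ k r → a k * (b k r * h r x)) ⟩
        sum (λ r → sum (λ k → a k * (b k r * h r x)))
      ≡⟨ sum-cong-≗ (λ r → trans (sum-cong-≗ (λ k → sym (*-assoc (a k) (b k r) (h r x))))
                                 (sym (*-distribʳ-sum (h r x) (λ k → a k * b k r)))) ⟩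
        sum (λ r → sum (λ k → a k * b k r) * h r x)
      ∎
      where
      open ≡-Reasoning
      b : Fin n → Vector ℤ m
      b k = proj₁ (g∈h k)
      g≡ : ∀ k x → g k x ≡ sum (λ r → b k r * h r x)
      g≡ k = proj₂ (g∈h k)

  InSpan-member : ∀ {v n} {g : Fin n → Vector ℤ v → ℤ} k → InSpan g (g k)
  InSpan-member {g = g} k = unit k , λ x → sym (sum-unit k (λ i → g i x))
    where
    unit : ∀ {n} → Fin n → Vector ℤ n
    unit zero    zero    = 1ℤ
    unit zero    (suc _) = 0ℤ
    unit (suc _) zero    = 0ℤ
    unit (suc k) (suc l) = unit k l

    sum-unit : ∀ {n} (k : Fin n) (h : Vector ℤ n) → sum (λ i → unit k i * h i) ≡ h k
    sum-unit {suc n} zero h =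
      trans (cong (1ℤ * h zero +_)
                  (trans (sum-cong-≗ (λ i → *-zeroˡ (h (suc i)))) (sum-replicate-zero n)))
            (trans (+-identityʳ _) (*-identityˡ _))
    sum-unit (suc k) h = trans (+-identityˡ _) (sum-unit k (tail h))

  InSpan-precompose : ∀ {u v n} {g : Fin n → Vector ℤ v → ℤ} {f} (σ : Vector ℤ u → Vector ℤ v) →
    InSpan g f → InSpan (λ k → g k ∘ σ) (f ∘ σ)
  InSpan-precompose σ (a , f≡) = a , f≡ ∘ σ

  -- Number of monomials of degree d in v variables, C(v-1+d, d): a monomial of
  -- degree d+1 in v+1 variables either contains x₀, or lives in x₁,…,x_v.
  monomialCount : ℕ → ℕ → ℕ
  monomialCount _       zero    = 1
  monomialCount zero    (suc d) = 0
  monomialCount (suc v) (suc d) = monomialCount (suc v) d ℕ.+ monomialCount v (suc d)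

  monomial : ∀ v d → Fin (monomialCount v d) → Vector ℤ v → ℤ
  monomial _       zero    _ x = 1ℤ
  monomial (suc v) (suc d) k x =
    [ (λ k′ → x zero * monomial (suc v) d k′ x) , (λ k′ → monomial v (suc d) k′ (tail x)) ]′
      (splitAt (monomialCount (suc v) d) k)

  Homogeneous : ∀ v → ℕ → (Vector ℤ v → ℤ) → Set
  Homogeneous v d = InSpan (monomial v d)

  monomial-↑ˡ : ∀ v d k x →
    monomial (suc v) (suc d) (k ↑ˡ monomialCount v (suc d)) x ≡ x zero * monomial (suc v) d k x
  monomial-↑ˡ v d k x rewrite splitAt-↑ˡ (monomialCount (suc v) d) k (monomialCount v (suc d)) = refl

  monomial-↑ʳ : ∀ v d k x →
    monomial (suc v) (suc d) (monomialCount (suc v) d ↑ʳ k) x ≡ monomial v (suc d) k (tail x)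
  monomial-↑ʳ v d k x rewrite splitAt-↑ʳ (monomialCount (suc v) d) (monomialCount v (suc d)) k = refl

  first*-homogeneous : ∀ v d {f} → Homogeneous (suc v) d f →
    Homogeneous (suc v) (suc d) (λ x → x zero * f x)
  first*-homogeneous v d hf =
    InSpan-trans (λ k → InSpan-resp (InSpan-member (k ↑ˡ _)) (λ x → sym (monomial-↑ˡ v d k x)))
                 (InSpan-scale (λ x → x zero) hf)

  tail-homogeneous : ∀ v d {f} → Homogeneous v (suc d) f → Homogeneous (suc v) (suc d) (f ∘ tail)
  tail-homogeneous v d hf =
    InSpan-trans (λ k → InSpan-resp (InSpan-member (_ ↑ʳ k)) (λ x → sym (monomial-↑ʳ v d k x)))
                 (InSpan-precompose tail hf)

  variable*-monomial : ∀ v d (r : Fin v) k → Homogeneous v (suc d) (λ x → x r * monomial v d k x)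
  variable*-monomial (suc v) d       zero    k =
    InSpan-resp (InSpan-member (k ↑ˡ _)) (λ x → sym (monomial-↑ˡ v d k x))
  variable*-monomial (suc v) zero    (suc r) k = tail-homogeneous v zero (variable*-monomial v zero r k)
  variable*-monomial (suc v) (suc d) (suc r) k with splitAt (monomialCount (suc v) d) k
  ... | inj₁ k′ = InSpan-resp (first*-homogeneous v (suc d) (variable*-monomial (suc v) d (suc r) k′))
                              (λ x → swap (x (suc r)) (x zero) (monomial (suc v) d k′ x))
    where
    swap : ∀ p q r → p * (q * r) ≡ q * (p * r)
    swap = solve-∀
  ... | inj₂ k′ = tail-homogeneous v (suc d) (variable*-monomial v (suc d) r k′)

  variable*-homogeneous : ∀ v d (r : Fin v) {f} → Homogeneous v d f →
    Homogeneous v (suc d) (λ x → x r * f x)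
  variable*-homogeneous v d r hf = InSpan-trans (variable*-monomial v d r) (InSpan-scale (λ x → x r) hf)

  linear*-homogeneous : ∀ v d (α : Vector ℤ v) {f} → Homogeneous v d f →
    Homogeneous v (suc d) (λ x → (α · x) * f x)
  linear*-homogeneous v d α {f} hf =
    InSpan-trans (λ r → variable*-homogeneous v d r hf)
      (α , λ x → trans (*-distribʳ-sum (f x) (λ r → α r * x r))
                       (sum-cong-≗ (λ r → *-assoc (α r) (x r) (f x))))

  ∏-linear-homogeneous : ∀ {k} v (s : Subset k) (α : Fin k → Vector ℤ v) {d} → ∣ s ∣ ≡ d →
    Homogeneous v d (λ x → ∏ s (λ y → α y · x))
  ∏-linear-homogeneous v s α refl = go s α
    where
    go : ∀ {k} (s : Subset k) (α : Fin k → Vector ℤ v) → Homogeneous v ∣ s ∣ (λ x → ∏ s (λ y → α y · x))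
    go []          α = InSpan-member {g = monomial v zero} zero
    go (true ∷ s)  α = linear*-homogeneous v ∣ s ∣ (α zero) (go s (α ∘ suc))
    go (false ∷ s) α = go s (α ∘ suc)

  monomialCount-one : ∀ d → monomialCount 1 d ≡ 1
  monomialCount-one zero    = refl
  monomialCount-one (suc d) = trans (ℕₚ.+-identityʳ _) (monomialCount-one d)

  monomialCount-two : ∀ d → monomialCount 2 d ≡ suc d
  monomialCount-two zero    = refl
  monomialCount-two (suc d) =
    trans (cong₂ ℕ._+_ (monomialCount-two d) (monomialCount-one (suc d))) (ℕₚ.+-comm (suc d) 1)

  monomialCount-binomial : ∀ u d → monomialCount (suc u) d ≡ (u ℕ.+ d) C d
  monomialCount-binomial u       zero    = refl
  monomialCount-binomial zero    (suc d) = trans (monomialCount-one (suc d)) (sym (nCn≡1 (suc d)))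
  monomialCount-binomial (suc u) (suc d) = begin
      monomialCount (suc (suc u)) d ℕ.+ monomialCount (suc u) (suc d)
    ≡⟨ cong₂ ℕ._+_ (monomialCount-binomial (suc u) d) (monomialCount-binomial u (suc d)) ⟩
      (suc u ℕ.+ d) C d ℕ.+ (u ℕ.+ suc d) C suc d
    ≡⟨ cong (λ n → (suc u ℕ.+ d) C d ℕ.+ n C suc d) (ℕₚ.+-suc u d) ⟩
      (suc u ℕ.+ d) C d ℕ.+ (suc u ℕ.+ d) C suc d
    ≡⟨ nCk+nC[k+1]≡[n+1]C[k+1] (suc u ℕ.+ d) d ⟩
      suc (suc u ℕ.+ d) C suc d
    ≡⟨ cong (_C suc d) (sym (ℕₚ.+-suc (suc u) d)) ⟩
      (suc u ℕ.+ suc d) C suc d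
    ∎
    where open ≡-Reasoning


module SkewBollobas where

  open import Data.Nat as ℕ using (ℕ)
  open import Data.Nat.Combinatorics using (_C_)
  open import Data.Integer using (ℤ; +_; _+_; _-_; _*_; -_; 0ℤ; 1ℤ)
  open import Data.Integer.Properties using (*-comm; +-inverseʳ; +-injective; i-j≡0⇒i≡j)
  open import Data.Integer.Tactic.RingSolver using (solve-∀)
  open import Data.Fin using (Fin; zero; suc; toℕ; _<_)
  open import Data.Fin.Properties using (toℕ-injective)
  open import Data.Fin.Subset using (Subset; _∈_; _∩_; ∣_∣; Nonempty)
  open import Data.Fin.Subset.Properties using (x∈p∩q⁺; x∈p∩q⁻)
  open import Data.Product using (_,_; proj₁; proj₂)
  open import Relation.Nullary using (¬_)
  open import Relation.Binary.PropositionalEquality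
  open IntegerVectors
  open TriangularRank
  open SubsetProducts
  open HomogeneousPolynomials

  module _ {k : ℕ} where

    ⟦_⟧ : Fin k → ℤ
    ⟦ x ⟧ = + toℕ x

    root point : Fin k → Vector ℤ 2
    root x zero       = 1ℤ
    root x (suc zero) = - ⟦ x ⟧
    point y zero       = ⟦ y ⟧
    point y (suc zero) = 1ℤ

    root·point : ∀ x y → root x · point y ≡ ⟦ y ⟧ - ⟦ x ⟧
    root·point x y = expand ⟦ y ⟧ ⟦ x ⟧
      where
      expand : ∀ y x → 1ℤ * y + ((- x) * 1ℤ + 0ℤ) ≡ y - x
      expand = solve-∀

    root·point≡0⇒≡ : ∀ x y → root x · point y ≡ 0ℤ → x ≡ y
    root·point≡0⇒≡ x y e =
      sym (toℕ-injective (+-injective (i-j≡0⇒i≡j ⟦ y ⟧ ⟦ x ⟧ (trans (sym (root·point x y)) e))))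

    root·point-self : ∀ y → root y · point y ≡ 0ℤ
    root·point-self y = trans (root·point y y) (+-inverseʳ ⟦ y ⟧)

    -- R_A(z) = ∏_{x∈A} (z₀ - x·z₁), whose zeros among the points are exactly A.
    rootPolynomial : Subset k → Vector ℤ 2 → ℤ
    rootPolynomial A z = ∏ A (λ x → root x · z)

    coefficients : ∀ {a} (A : Subset k) → ∣ A ∣ ≡ a → Vector ℤ (monomialCount 2 a)
    coefficients A |A| = proj₁ (∏-linear-homogeneous 2 A root |A|)

    moment : ∀ a → Fin k → Vector ℤ (monomialCount 2 a)
    moment a y q = monomial 2 a q (point y)

    rootPolynomial-at : ∀ {a} (A : Subset k) (|A| : ∣ A ∣ ≡ a) y →
      rootPolynomial A (point y) ≡ moment a y · coefficients A |A|
    rootPolynomial-at {a} A |A| y =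
      trans (proj₂ (∏-linear-homogeneous 2 A root |A|) (point y))
            (sum-cong-≗ (λ q → *-comm (coefficients A |A| q) (moment a y q)))

    evaluation : ∀ a → Subset k → Vector ℤ (monomialCount 2 a) → ℤ
    evaluation a B c = ∏ B (λ y → moment a y · c)

    evaluation-coefficients : ∀ {a} (A B : Subset k) (|A| : ∣ A ∣ ≡ a) →
      evaluation a B (coefficients A |A|) ≡ ∏ B (λ y → rootPolynomial A (point y))
    evaluation-coefficients A B |A| = ∏-cong B (λ y → sym (rootPolynomial-at A |A| y))

    evaluation≡0⇒meet : ∀ {a} (A B : Subset k) (|A| : ∣ A ∣ ≡ a) →
      evaluation a B (coefficients A |A|) ≡ 0ℤ → Nonempty (A ∩ B)
    evaluation≡0⇒meet A B |A| e
      with ∏≡0⇒factor≡0 B _ (trans (sym (evaluation-coefficients A B |A|)) e)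
    ... | y , y∈B , RAy≡0 with ∏≡0⇒factor≡0 A _ RAy≡0
    ...   | x , x∈A , xy≡0 = y , x∈p∩q⁺ (subst (_∈ A) (root·point≡0⇒≡ x y xy≡0) x∈A , y∈B)

    meet⇒evaluation≡0 : ∀ {a} (A B : Subset k) (|A| : ∣ A ∣ ≡ a) →
      Nonempty (A ∩ B) → evaluation a B (coefficients A |A|) ≡ 0ℤ
    meet⇒evaluation≡0 A B |A| (y , y∈A∩B) =
      trans (evaluation-coefficients A B |A|)
            (factor≡0⇒∏≡0 B _ y (proj₂ (x∈p∩q⁻ A B y∈A∩B))
              (factor≡0⇒∏≡0 A _ y (proj₁ (x∈p∩q⁻ A B y∈A∩B)) (root·point-self y)))

  skewBollobas : ∀ {k} a b m (A B : Fin m → Subset k) →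
    (∀ i → ∣ A i ∣ ≡ a) → (∀ i → ∣ B i ∣ ≡ b) →
    (∀ i → ¬ Nonempty (A i ∩ B i)) → (∀ i j → j < i → Nonempty (A i ∩ B j)) →
    m ℕ.≤ (a ℕ.+ b) C b
  skewBollobas a b m A B |A| |B| disjoint meet =
    subst (m ℕ.≤_) dimension (triangularRank m N w β lower diagonal)
    where
    N : ℕ
    N = monomialCount (monomialCount 2 a) b

    dimension : N ≡ (a ℕ.+ b) C b
    dimension = trans (cong (λ v → monomialCount v b) (monomialCount-two a)) (monomialCount-binomial a b)

    f-homogeneous : ∀ j → Homogeneous (monomialCount 2 a) b (evaluation a (B j))
    f-homogeneous j = ∏-linear-homogeneous (monomialCount 2 a) (B j) (moment a) (|B| j)

    w β : Fin m → Vector ℤ N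
    w i q = monomial (monomialCount 2 a) b q (coefficients (A i) (|A| i))
    β j = proj₁ (f-homogeneous j)

    pairing : ∀ i j → w i · β j ≡ evaluation a (B j) (coefficients (A i) (|A| i))
    pairing i j = sym (trans (proj₂ (f-homogeneous j) (coefficients (A i) (|A| i)))
                             (sum-cong-≗ (λ q → *-comm (β j q) (w i q))))

    lower : ∀ i j → j < i → w i · β j ≡ 0ℤ
    lower i j j<i = trans (pairing i j) (meet⇒evaluation≡0 (A i) (B j) (|A| i) (meet i j j<i))

    diagonal : ∀ i → ¬ w i · β i ≡ 0ℤ
    diagonal i e = disjoint i (evaluation≡0⇒meet (A i) (B i) (|A| i) (trans (sym (pairing i i)) e))


open import Defs
open import Data.Nat using (ℕ; suc; _+_; _*_; _∸_; _≤_)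
open import Data.Nat.Combinatorics using (_C_)
open import Data.Nat using (_<_; z≤n; s≤s; s≤s⁻¹; NonZero)
open import Data.Nat.Properties
  using (+-assoc; +-suc; +-identityʳ; m+n∸m≡n; m+[n∸m]≡n; m∸n≤m; ∸-monoˡ-≤; ≤-trans;
         ≤-refl; ≤-pred; <-≤-trans; ≤-<-trans; m≤n⇒m<n∨m≡n; suc-injective;
         m+1+n≰m; m<m+n; +-monoˡ-≤; module ≤-Reasoning)
open import Data.Nat.DivMod using (_%_; m<n⇒m%n≡m; [m+n]%n≡m%n; n%n≡0; m%n<n)
open import Data.Fin as Fin using (Fin; toℕ; fromℕ<)
open import Data.Fin.Properties using (toℕ-fromℕ<; toℕ<n)
open import Data.Product using (_,_)
open import Data.Sum using (_⊎_; inj₁; inj₂)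
open import Function using (_∘_)
open import Function.Bundles using (Equivalence)
open import Relation.Nullary using (¬_)
open import Relation.Binary.PropositionalEquality
open SkewBollobas using (skewBollobas)

circulantOffset : ∀ n .{{_ : NonZero n}} a b r → r < n → b + r ≡ a ⊎ b + r ≡ a + n →
  ((a + n) ∸ b) % n ≡ r
circulantOffset n a b r r<n (inj₁ refl) =
  trans (cong (_% n) (trans (cong (_∸ b) (+-assoc b r n)) (m+n∸m≡n b (r + n))))
        (trans ([m+n]%n≡m%n r n) (m<n⇒m%n≡m r<n))
circulantOffset n a b r r<n (inj₂ b+r≡a+n) =
  trans (cong (λ z → (z ∸ b) % n) (sym b+r≡a+n))
        (trans (cong (_% n) (m+n∸m≡n b r)) (m<n⇒m%n≡m r<n))

module CirculantSkewFamily (p q : ℕ) where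

  n m : ℕ
  n = suc p + suc q
  m = suc (suc p)

  m≤n : m ≤ n
  m≤n = s≤s (m<m+n p (s≤s z≤n))

  row nextColumn : Fin m → Fin n
  row i        = fromℕ< (≤-trans (toℕ<n i) m≤n)
  nextColumn j = fromℕ< (m%n<n (suc (toℕ j)) n)

  entryValue : ℕ → ℕ → ℕ
  entryValue a b = ((a + n) ∸ b) % n

  entryValue-pair : ∀ i j →
    entryValue (toℕ (row i)) (toℕ (nextColumn j)) ≡ entryValue (toℕ i) (suc (toℕ j) % n)
  entryValue-pair i j =
    cong₂ entryValue (toℕ-fromℕ< (≤-trans (toℕ<n i) m≤n)) (toℕ-fromℕ< (m%n<n (suc (toℕ j)) n))

  nextColumnOffset : ∀ a → suc a ≤ n → entryValue a (suc a % n) ≡ p + suc q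
  nextColumnOffset a a<n with m≤n⇒m<n∨m≡n a<n
  ... | inj₁ a+1<n =
    trans (cong (entryValue a) (m<n⇒m%n≡m a+1<n))
          (circulantOffset n a (suc a) (p + suc q) ≤-refl (inj₂ (sym (+-suc a (p + suc q)))))
  ... | inj₂ a+1≡n =
    trans (cong (entryValue a) (trans (cong (_% n) a+1≡n) (n%n≡0 n)))
          (circulantOffset n a 0 (p + suc q) ≤-refl (inj₁ (sym (suc-injective a+1≡n))))

  earlierColumnOffset : ∀ a b → suc b ≤ a → a < m → entryValue a (suc b % n) ≡ a ∸ suc b
  earlierColumnOffset a b b<a a<m =
    trans (cong (entryValue a) (m<n⇒m%n≡m (≤-<-trans b<a a<n)))
          (circulantOffset n a (suc b) (a ∸ suc b) (≤-<-trans (m∸n≤m a (suc b)) a<n)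
            (inj₁ (m+[n∸m]≡n b<a)))
    where
    a<n : a < n
    a<n = <-≤-trans a<m m≤n

  diagonal-zero : ∀ i → ¬ CEntry (suc p) (suc q) (row i) (nextColumn i)
  diagonal-zero i entry = m+1+n≰m p (s≤s⁻¹ (subst (_< suc p) value entry))
    where
    value : entryValue (toℕ (row i)) (toℕ (nextColumn i)) ≡ p + suc q
    value = trans (entryValue-pair i i) (nextColumnOffset (toℕ i) (≤-trans (toℕ<n i) m≤n))

  below-diagonal-one : ∀ i j → j Fin.< i → CEntry (suc p) (suc q) (row i) (nextColumn j)
  below-diagonal-one i j j<i =
    subst (_< suc p) (sym value)
          (s≤s (≤-trans (∸-monoˡ-≤ (suc (toℕ j)) (≤-pred (toℕ<n i))) (m∸n≤m p (toℕ j))))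
    where
    value : entryValue (toℕ (row i)) (toℕ (nextColumn j)) ≡ toℕ i ∸ suc (toℕ j)
    value = trans (entryValue-pair i j) (earlierColumnOffset (toℕ i) (toℕ j) j<i (toℕ<n i))

mainTheorem9 : (k t p q : ℕ) → 1 ≤ k → 1 ≤ t → 1 ≤ q →
    CircSubmatrixOf (suc p) q k t →
    suc p + q ≤ (2 * t) C t + q ∸ 1
mainTheorem9 k t p (suc q) _ _ _ (F , G , _ , _ , |F| , |G| , entry) = begin
    suc p + suc q             ≡⟨ +-suc (suc p) q ⟩
    suc (suc p) + q           ≤⟨ +-monoˡ-≤ q skewBound ⟩
    (2 * t) C t + q           ≡⟨ sym (cong (_∸ 1) (+-suc ((2 * t) C t) q)) ⟩
    (2 * t) C t + suc q ∸ 1   ∎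
  where
  open ≤-Reasoning
  open CirculantSkewFamily p q

  skewBound : suc (suc p) ≤ (2 * t) C t
  skewBound = subst (λ s → suc (suc p) ≤ s C t) (cong (t +_) (sym (+-identityʳ t)))
    (skewBollobas t t (suc (suc p)) (F ∘ row) (G ∘ nextColumn) (|F| ∘ row) (|G| ∘ nextColumn)
      (λ i → diagonal-zero i ∘ Equivalence.from (entry (row i) (nextColumn i)))
      (λ i j j<i → Equivalence.to (entry (row i) (nextColumn j)) (below-diagonal-one i j j<i)))
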